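{- For all $f,g\in z\mathbb{Q}[[q,z]]$ and all $\alpha,\beta\in\{a,b\}$, $(\alpha\cdot f)(\beta\cdot g)=\alpha\cdot\big(f\,(\beta\cdot g)\big)+\beta\cdot\big((\alpha\cdot f)\,g\big)+(\alpha\diamond_q\beta)\cdot(fg)$.
   Context: Let $\hbar$ be a formal variable, $\mathcal C=\mathbb{Q}[\hbar,\hbar^{ -1}]$, $\widehat{\mathfrak H}=\mathcal C\langle a,b\rangle$, and let $\hbar$ act on $\mathbb{Q}[[q,z]]$ as multiplication by $1-q$. Elements of $\widehat{\mathfrak H}$ act on $\mathbb{Q}[[q,z]]$ via: for $g\in z\mathbb{Q}[[q,z]]$, $a\cdot g=(1-q)\sum_{j=1}^\infty g|_{z=q^jz}$ and $b\cdot g=\frac{z}{1-z}g$; a word acts letter by letter from the right, $(w_1w_2)\cdot g=w_1\cdot(w_2\cdot g)$, extended $\mathcal C$-linearly. $\diamond_q$ is the $\mathcal C$-bilinear map with $a\diamond_q b=b\diamond_q a=-ab$, $b\diamond_q b=-bb$, $a\diamond_q a=\hbar a$. -}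

module Defs where

open import Data.Nat as ℕ using (ℕ; zero; suc; _∸_; _≤?_)
open import Data.Integer as ℤ using (ℤ; +_; -[1+_])
open import Data.Rational using (ℚ; 0ℚ; 1ℚ; _+_; _*_; -_; _-_)
open import Data.List using (List; []; _∷_)
open import Data.Product using (_×_; _,_)
open import Relation.Nullary using (yes; no)

-- A formal power series in ℚ[[q,z]], given by its coefficients:
-- f m n = coefficient of q^m z^n.
Series : Set
Series = ℕ → ℕ → ℚ

InZ : Series → Set
InZ f = ∀ m → f m 0 ≡ 0ℚ
  where open import Relation.Binary.PropositionalEquality using (_≡_)

sumTo : ℕ → (ℕ → ℚ) → ℚ
sumTo zero    h = h 0
sumTo (suc n) h = sumTo n h + h (suc n)

sumFrom1 : ℕ → (ℕ → ℚ) → ℚ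
sumFrom1 zero    h = 0ℚ
sumFrom1 (suc n) h = sumFrom1 n h + h (suc n)

_⊕_ : Series → Series → Series
(f ⊕ g) m n = f m n + g m n

zeroS : Series
zeroS m n = 0ℚ

_⊗_ : Series → Series → Series
(f ⊗ g) m n = sumTo m λ i → sumTo n λ j → f i j * g (m ∸ i) (n ∸ j)

scaleS : ℚ → Series → Series
scaleS c f m n = c * f m n

mul1-q : Series → Series
mul1-q h zero    n = h zero n
mul1-q h (suc m) n = h (suc m) n - h m n

div1-q : Series → Series
div1-q h m n = sumTo m λ i → h i n

iter : ℕ → (Series → Series) → Series → Series
iter zero    F h = h
iter (suc k) F h = F (iter k F h)

-- action of ℏ^k (ℏ acts as multiplication by 1 - q)
hbarPow : ℤ → Series → Series
hbarPow (+ k)     = iter k mul1-q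
hbarPow -[1+ k ]  = iter (suc k) div1-q

-- Σ_{j ≥ 1} g(q, q^j z); coefficient of q^M z^n for n ≥ 1 is
-- Σ_{j ≥ 1, j n ≤ M} g_{M - j n, n}  (finite).  At n = 0 we put 0, which is
-- correct for g ∈ z ℚ[[q,z]], the only series on which the action is defined.
shiftSum : Series → Series
shiftSum g M zero    = 0ℚ
shiftSum g M (suc n) = sumFrom1 M λ j → aux (j ℕ.* suc n)
  where
  aux : ℕ → ℚ
  aux k with k ≤? M
  ... | yes _ = g (M ∸ k) (suc n)
  ... | no  _ = 0ℚ

actA : Series → Series
actA g = mul1-q (shiftSum g)

-- b · g = z/(1 - z) g ; coefficient of q^m z^n is Σ_{k < n} g_{m,k}
actB : Series → Series
actB g m zero    = 0ℚ
actB g m (suc n) = sumTo n λ k → g m k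

data Letter : Set where
  a b : Letter

actLetter : Letter → Series → Series
actLetter a = actA
actLetter b = actB

actWord : List Letter → Series → Series
actWord []      g = g
actWord (x ∷ w) g = actLetter x (actWord w g)

-- Elements of Ĥ = 𝒞⟨a,b⟩, 𝒞 = ℚ[ℏ,ℏ⁻¹], as finite formal sums of terms
-- c ℏ^k w  (c ∈ ℚ, k ∈ ℤ, w a word).
Hhat : Set
Hhat = List (ℚ × ℤ × List Letter)

actH : Hhat → Series → Series
actH []                  g = zeroS
actH ((c , k , w) ∷ ts) g = scaleS c (hbarPow k (actWord w g)) ⊕ actH ts g

_⋄q_ : Letter → Letter → Hhat
a ⋄q a = (1ℚ , + 1 , a ∷ []) ∷ []
a ⋄q b = (- 1ℚ , + 0 , a ∷ b ∷ []) ∷ []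
b ⋄q a = (- 1ℚ , + 0 , a ∷ b ∷ []) ∷ []
b ⋄q b = (- 1ℚ , + 0 , b ∷ b ∷ []) ∷ []

_≈S_ : Series → Series → Set
f ≈S g = ∀ m n → f m n ≡ g m n
  where open import Relation.Binary.PropositionalEquality using (_≡_)

-- Regard ℚ[[q,z]] as ℚ[[q]][[z]]. Then b multiplies by u = z/(1 − z), and a is (1 − q) times
-- the diagonal operator D(Σ gₙ zⁿ) = Σ cₙ gₙ zⁿ with cₙ = qⁿ/(1 − qⁿ), c₀ = 0. When a letter is b
-- the identity is a rearrangement in the commutative ring ℚ[[q]][[z]], the ⋄q-term cancelling a
-- duplicated summand. For α = β = a it is (1 − q)² times the weight-one Rota–Baxter identity
-- D F · D G = D(F · D G) + D(D F · G) + D(F · G), valid on z ℚ[[q]][[z]]; on zⁿ · zᵐ it reads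
-- cₙ cₘ = cₙ₊ₘ (1 + cₙ + cₘ), which follows from the fixed-point equations cₙ = qⁿ (1 + cₙ).
module Submission where

open import Algebra.Bundles using (CommutativeRing)
open import Data.Nat as ℕ using (ℕ; zero; suc; _∸_; _≤_; _<_; z≤n; s≤s)
import Data.Nat.Properties as ℕ
import Algebra.Properties.Ring
open import Data.Empty using (⊥-elim)
open import Data.Product using (_,_)
open import Data.Sum using (inj₁; inj₂)
open import Relation.Nullary using (yes; no)
open import Function using (_∘_)
open import Relation.Binary.Structures using (IsEquivalence)
open import Relation.Binary.PropositionalEquality as ≡ using (_≡_)

open import Defs

module FiniteSum {c ℓ} (R : CommutativeRing c ℓ) where
  open CommutativeRing R
  open import Relation.Binary.Reasoning.Setoid setoid
  open import Algebra.Solver.Ring.NaturalCoefficients.Default commutativeSemiring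

  Σ : ℕ → (ℕ → Carrier) → Carrier
  Σ zero    h = h 0
  Σ (suc n) h = Σ n h + h (suc n)

  Σ-cong : ∀ n {h k : ℕ → Carrier} → (∀ i → i ≤ n → h i ≈ k i) → Σ n h ≈ Σ n k
  Σ-cong zero    h≈k = h≈k 0 z≤n
  Σ-cong (suc n) h≈k = +-cong (Σ-cong n λ i i≤n → h≈k i (ℕ.m≤n⇒m≤1+n i≤n)) (h≈k (suc n) ℕ.≤-refl)

  Σ-zero : ∀ n {h : ℕ → Carrier} → (∀ i → i ≤ n → h i ≈ 0#) → Σ n h ≈ 0#
  Σ-zero zero    h≈0 = h≈0 0 z≤n
  Σ-zero (suc n) h≈0 = trans (+-cong (Σ-zero n λ i i≤n → h≈0 i (ℕ.m≤n⇒m≤1+n i≤n)) (h≈0 (suc n) ℕ.≤-refl))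
                             (+-identityˡ 0#)

  Σ-distrib-+ : ∀ n (h k : ℕ → Carrier) → Σ n (λ i → h i + k i) ≈ Σ n h + Σ n k
  Σ-distrib-+ zero    h k = refl
  Σ-distrib-+ (suc n) h k = begin
    Σ n (λ i → h i + k i) + (h (suc n) + k (suc n))  ≈⟨ +-congʳ (Σ-distrib-+ n h k) ⟩
    (Σ n h + Σ n k) + (h (suc n) + k (suc n))        ≈⟨ solve 4 (λ a b x y → (a :+ b) :+ (x :+ y) := (a :+ x) :+ (b :+ y))
                                                                refl (Σ n h) (Σ n k) (h (suc n)) (k (suc n)) ⟩
    (Σ n h + h (suc n)) + (Σ n k + k (suc n))        ∎

  *-distribˡ-Σ : ∀ n x (h : ℕ → Carrier) → x * Σ n h ≈ Σ n (λ i → x * h i)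
  *-distribˡ-Σ zero    x h = refl
  *-distribˡ-Σ (suc n) x h = trans (distribˡ x (Σ n h) (h (suc n))) (+-congʳ (*-distribˡ-Σ n x h))

  *-distribʳ-Σ : ∀ n x (h : ℕ → Carrier) → Σ n h * x ≈ Σ n (λ i → h i * x)
  *-distribʳ-Σ n x h = trans (*-comm (Σ n h) x) (trans (*-distribˡ-Σ n x h) (Σ-cong n λ i _ → *-comm x (h i)))

  Σ-suc : ∀ n (h : ℕ → Carrier) → Σ (suc n) h ≈ h 0 + Σ n (λ i → h (suc i))
  Σ-suc zero    h = refl
  Σ-suc (suc n) h = trans (+-congʳ (Σ-suc n h)) (+-assoc _ _ _)

  Σ-reverse : ∀ n (h : ℕ → Carrier) → Σ n (λ i → h (n ∸ i)) ≈ Σ n h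
  Σ-reverse zero    h = refl
  Σ-reverse (suc n) h = begin
    Σ (suc n) (λ i → h (suc n ∸ i))  ≈⟨ Σ-suc n _ ⟩
    h (suc n) + Σ n (λ i → h (n ∸ i)) ≈⟨ +-congˡ (Σ-reverse n h) ⟩
    h (suc n) + Σ n h                 ≈⟨ +-comm _ _ ⟩
    Σ (suc n) h                       ∎

  Σ-comm : ∀ m n (h : ℕ → ℕ → Carrier) → Σ m (λ i → Σ n (h i)) ≈ Σ n (λ j → Σ m (λ i → h i j))
  Σ-comm zero    n h = refl
  Σ-comm (suc m) n h = trans (+-congʳ (Σ-comm m n h)) (sym (Σ-distrib-+ n _ _))

  Σ-triangle : ∀ m (h : ℕ → ℕ → Carrier) →
               Σ m (λ i → Σ (m ∸ i) (h i)) ≈ Σ m (λ s → Σ s (λ i → h i (s ∸ i)))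
  Σ-triangle zero    h = refl
  Σ-triangle (suc m) h = begin
    Σ (suc m) (λ i → Σ (suc m ∸ i) (h i))
      ≈⟨ Σ-suc m _ ⟩
    Σ (suc m) (h 0) + Σ m (λ i → Σ (m ∸ i) (h (suc i)))
      ≈⟨ +-cong (Σ-suc m _) (Σ-triangle m (λ i → h (suc i))) ⟩
    (h 0 0 + Σ m (λ s → h 0 (suc s))) + Σ m (λ s → Σ s (λ i → h (suc i) (s ∸ i)))
      ≈⟨ trans (+-assoc _ _ _) (+-congˡ (sym (Σ-distrib-+ m _ _))) ⟩
    h 0 0 + Σ m (λ s → h 0 (suc s) + Σ s (λ i → h (suc i) (s ∸ i)))
      ≈⟨ +-congˡ (Σ-cong m λ s _ → sym (Σ-suc s (λ i → h i (suc s ∸ i)))) ⟩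
    h 0 0 + Σ m (λ s → Σ (suc s) (λ i → h i (suc s ∸ i)))
      ≈⟨ sym (Σ-suc m _) ⟩
    Σ (suc m) (λ s → Σ s (λ i → h i (s ∸ i)))
      ∎

module FormalPowerSeries {c ℓ} (R : CommutativeRing c ℓ) where
  open CommutativeRing R
  open FiniteSum R public
  open import Algebra.Properties.CommutativeSemigroup *-commutativeSemigroup using (x∙yz≈y∙xz)
  open import Relation.Binary.Reasoning.Setoid setoid

  record PowerSeries : Set c where
    no-eta-equality
    constructor series
    field coeff : ℕ → Carrier
  open PowerSeries public

  infix 4 _≋_
  record _≋_ (f g : PowerSeries) : Set ℓ where
    constructor coeffwise
    field coeff-≈ : ∀ i → coeff f i ≈ coeff g i
  open _≋_ public

  ≋-isEquivalence : IsEquivalence _≋_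
  ≋-isEquivalence = record
    { refl  = coeffwise λ i → refl
    ; sym   = λ f≋g → coeffwise λ i → sym (coeff-≈ f≋g i)
    ; trans = λ f≋g g≋h → coeffwise λ i → trans (coeff-≈ f≋g i) (coeff-≈ g≋h i)
    }

  infixl 6 _+ₛ_
  infixl 7 _*ₛ_

  _+ₛ_ : PowerSeries → PowerSeries → PowerSeries
  coeff (f +ₛ g) i = coeff f i + coeff g i

  -ₛ_ : PowerSeries → PowerSeries
  coeff (-ₛ f) i = - coeff f i

  _*ₛ_ : PowerSeries → PowerSeries → PowerSeries
  coeff (f *ₛ g) m = Σ m (λ i → coeff f i * coeff g (m ∸ i))

  const : Carrier → PowerSeries
  coeff (const x) zero    = x
  coeff (const x) (suc _) = 0#

  0ₛ : PowerSeries
  coeff 0ₛ i = 0#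

  1ₛ : PowerSeries
  1ₛ = const 1#

  coeff-const-* : ∀ x f m → coeff (const x *ₛ f) m ≈ x * coeff f m
  coeff-const-* x f zero    = refl
  coeff-const-* x f (suc m) = begin
    Σ (suc m) (λ i → coeff (const x) i * coeff f (suc m ∸ i))  ≈⟨ Σ-suc m _ ⟩
    x * coeff f (suc m) + Σ m (λ i → 0# * coeff f (m ∸ i))      ≈⟨ +-congˡ (Σ-zero m λ i _ → zeroˡ _) ⟩
    x * coeff f (suc m) + 0#                                    ≈⟨ +-identityʳ _ ⟩
    x * coeff f (suc m)                                         ∎

  *ₛ-comm : ∀ f g → f *ₛ g ≋ g *ₛ f
  *ₛ-comm f g = coeffwise λ m → begin
    Σ m (λ i → coeff f i * coeff g (m ∸ i))              ≈⟨ Σ-reverse m _ ⟨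
    Σ m (λ i → coeff f (m ∸ i) * coeff g (m ∸ (m ∸ i)))  ≈⟨ Σ-cong m (λ i i≤m → trans (*-comm _ _)
                                                              (*-congʳ (reflexive (≡.cong (coeff g) (ℕ.m∸[m∸n]≡n i≤m))))) ⟩
    Σ m (λ i → coeff g i * coeff f (m ∸ i))              ∎

  *ₛ-assoc : ∀ f g h → (f *ₛ g) *ₛ h ≋ f *ₛ (g *ₛ h)
  *ₛ-assoc f g h = coeffwise λ m → begin
    Σ m (λ s → Σ s (λ i → f′ i * g′ (s ∸ i)) * h′ (m ∸ s))
      ≈⟨ Σ-cong m (λ s _ → *-distribʳ-Σ s _ _) ⟩
    Σ m (λ s → Σ s (λ i → (f′ i * g′ (s ∸ i)) * h′ (m ∸ s)))
      ≈⟨ Σ-cong m (λ s _ → Σ-cong s λ i i≤s → trans (*-assoc _ _ _)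
           (*-congˡ (*-congˡ (reflexive (≡.cong h′ (m∸s≡m∸i∸[s∸i] i≤s)))))) ⟩
    Σ m (λ s → Σ s (λ i → f′ i * (g′ (s ∸ i) * h′ (m ∸ i ∸ (s ∸ i)))))
      ≈⟨ Σ-triangle m (λ i k → f′ i * (g′ k * h′ (m ∸ i ∸ k))) ⟨
    Σ m (λ i → Σ (m ∸ i) (λ k → f′ i * (g′ k * h′ (m ∸ i ∸ k))))
      ≈⟨ Σ-cong m (λ i _ → *-distribˡ-Σ (m ∸ i) _ _) ⟨
    Σ m (λ i → f′ i * Σ (m ∸ i) (λ k → g′ k * h′ (m ∸ i ∸ k)))
      ∎
    where
    f′ = coeff f
    g′ = coeff g
    h′ = coeff h
    m∸s≡m∸i∸[s∸i] : ∀ {m i s} → i ≤ s → m ∸ s ≡ m ∸ i ∸ (s ∸ i)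
    m∸s≡m∸i∸[s∸i] {m} {i} {s} i≤s = ≡.trans (≡.cong (m ∸_) (≡.sym (ℕ.m+[n∸m]≡n i≤s))) (≡.sym (ℕ.∸-+-assoc m i (s ∸ i)))

  powerSeriesRing : CommutativeRing c ℓ
  powerSeriesRing = record
    { Carrier = PowerSeries ; _≈_ = _≋_ ; _+_ = _+ₛ_ ; _*_ = _*ₛ_ ; -_ = -ₛ_ ; 0# = 0ₛ ; 1# = 1ₛ
    ; isCommutativeRing = record
      { isRing = record
        { +-isAbelianGroup = record
          { isGroup = record
            { isMonoid = record
              { isSemigroup = record
                { isMagma = record
                  { isEquivalence = ≋-isEquivalence
                  ; ∙-cong = λ f≋f′ g≋g′ → coeffwise λ i → +-cong (coeff-≈ f≋f′ i) (coeff-≈ g≋g′ i) }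
                ; assoc = λ f g h → coeffwise λ i → +-assoc _ _ _ }
              ; identity = (λ f → coeffwise (+-identityˡ ∘ coeff f)) , (λ f → coeffwise (+-identityʳ ∘ coeff f)) }
            ; inverse = (λ f → coeffwise (-‿inverseˡ ∘ coeff f)) , (λ f → coeffwise (-‿inverseʳ ∘ coeff f))
            ; ⁻¹-cong = λ f≋g → coeffwise λ i → -‿cong (coeff-≈ f≋g i) }
          ; comm = λ f g → coeffwise λ i → +-comm _ _ }
        ; *-cong = λ {f} {f′} {g} {g′} f≋f′ g≋g′ → coeffwise λ m →
                     Σ-cong m λ i _ → *-cong (coeff-≈ f≋f′ i) (coeff-≈ g≋g′ (m ∸ i))
        ; *-assoc = *ₛ-assoc
        ; *-identity = *ₛ-identityˡ , λ f → ≋.trans (*ₛ-comm f 1ₛ) (*ₛ-identityˡ f)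
        ; distrib = (λ f g h → coeffwise λ m → trans (Σ-cong m λ i _ → distribˡ _ _ _) (Σ-distrib-+ m _ _))
                  , (λ f g h → coeffwise λ m → trans (Σ-cong m λ i _ → distribʳ _ _ _) (Σ-distrib-+ m _ _)) }
      ; *-comm = *ₛ-comm } }
    where
    *ₛ-identityˡ : ∀ f → 1ₛ *ₛ f ≋ f
    *ₛ-identityˡ f = coeffwise λ m → trans (coeff-const-* 1# f m) (*-identityˡ _)
    module ≋ = IsEquivalence ≋-isEquivalence

  private
    module P = CommutativeRing powerSeriesRing
    module Pᴿ = Algebra.Properties.Ring P.ring

  x : PowerSeries
  coeff x zero    = 0#
  coeff x (suc i) = coeff 1ₛ i

  u : PowerSeries
  coeff u zero    = 0#
  coeff u (suc i) = 1#

  shift : ℕ → PowerSeries → PowerSeries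
  coeff (shift zero    f) m       = coeff f m
  coeff (shift (suc p) f) zero    = 0#
  coeff (shift (suc p) f) (suc m) = coeff (shift p f) m

  coeff-*-suc : ∀ f g m → coeff f 0 ≈ 0# →
                coeff (f *ₛ g) (suc m) ≈ Σ m (λ i → coeff f (suc i) * coeff g (m ∸ i))
  coeff-*-suc f g m f₀≈0 = begin
    Σ (suc m) (λ i → coeff f i * coeff g (suc m ∸ i))
      ≈⟨ Σ-suc m _ ⟩
    coeff f 0 * coeff g (suc m) + Σ m (λ i → coeff f (suc i) * coeff g (m ∸ i))
      ≈⟨ +-congʳ (trans (*-congʳ f₀≈0) (zeroˡ _)) ⟩
    0# + Σ m (λ i → coeff f (suc i) * coeff g (m ∸ i))
      ≈⟨ +-identityˡ _ ⟩
    Σ m (λ i → coeff f (suc i) * coeff g (m ∸ i))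
      ∎

  x*≋shift : ∀ f → x *ₛ f ≋ shift 1 f
  x*≋shift f = coeffwise λ where
    zero    → zeroˡ _
    (suc m) → trans (coeff-*-suc x f m refl) (coeff-≈ (P.*-identityˡ f) m)

  coeff-u*-zero : ∀ f → coeff (u *ₛ f) 0 ≈ 0#
  coeff-u*-zero f = zeroˡ _

  coeff-u*-suc : ∀ f n → coeff (u *ₛ f) (suc n) ≈ Σ n (coeff f)
  coeff-u*-suc f n = begin
    coeff (u *ₛ f) (suc n)          ≈⟨ coeff-*-suc u f n refl ⟩
    Σ n (λ i → 1# * coeff f (n ∸ i)) ≈⟨ Σ-cong n (λ i _ → *-identityˡ _) ⟩
    Σ n (λ i → coeff f (n ∸ i))      ≈⟨ Σ-reverse n (coeff f) ⟩
    Σ n (coeff f)                    ∎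

  coeff-[1-x]* : ∀ f m → coeff ((1ₛ +ₛ -ₛ x) *ₛ f) m ≈ coeff f m + - coeff (shift 1 f) m
  coeff-[1-x]* f m = coeff-≈ (P.trans (P.distribʳ f 1ₛ (-ₛ x))
                                     (P.+-cong (P.*-identityˡ f)
                                               (P.trans (P.sym (Pᴿ.-‿distribˡ-* x f)) (P.-‿cong (x*≋shift f))))) m

  diagonal : (ℕ → Carrier) → PowerSeries → PowerSeries
  coeff (diagonal w f) n = w n * coeff f n

  diagonal-cong : ∀ w {f g} → f ≋ g → diagonal w f ≋ diagonal w g
  diagonal-cong w f≋g = coeffwise λ n → *-congˡ (coeff-≈ f≋g n)

  diagonal-const-* : ∀ w k f → diagonal w (const k *ₛ f) ≋ const k *ₛ diagonal w f
  diagonal-const-* w k f = coeffwise λ n → begin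
    w n * coeff (const k *ₛ f) n   ≈⟨ *-congˡ (coeff-const-* k f n) ⟩
    w n * (k * coeff f n)          ≈⟨ x∙yz≈y∙xz (w n) k (coeff f n) ⟩
    k * (w n * coeff f n)          ≈⟨ coeff-const-* k (diagonal w f) n ⟨
    coeff (const k *ₛ diagonal w f) n ∎

  diagonal-rotaBaxter :
    ∀ w {f g} →
    (∀ n m → w (suc n) * w (suc m) ≈ w (suc n ℕ.+ suc m) * (1# + w (suc n) + w (suc m))) →
    coeff f 0 ≈ 0# → coeff g 0 ≈ 0# →
    diagonal w f *ₛ diagonal w g
      ≋ diagonal w (f *ₛ diagonal w g) +ₛ diagonal w (diagonal w f *ₛ g) +ₛ diagonal w (f *ₛ g)
  diagonal-rotaBaxter w {f} {g} w-law f₀≈0 g₀≈0 = coeffwise coeff-identity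
    where
    open import Algebra.Solver.Ring.NaturalCoefficients.Default commutativeSemiring
    f′ = coeff f
    g′ = coeff g

    *-annihilated : ∀ {r s p} → p ≈ 0# → r * p ≈ s * p
    *-annihilated p≈0 = trans (*-congˡ p≈0) (trans (zeroʳ _) (sym (trans (*-congˡ p≈0) (zeroʳ _))))

    weights : ∀ n m → (w n * w m) * (f′ n * g′ m) ≈ (w (n ℕ.+ m) * (1# + w n + w m)) * (f′ n * g′ m)
    weights zero    m       = *-annihilated (trans (*-congʳ f₀≈0) (zeroˡ _))
    weights (suc n) zero    = *-annihilated (trans (*-congˡ g₀≈0) (zeroʳ _))
    weights (suc n) (suc m) = *-congʳ (w-law n m)

    summand : ∀ n m N → n ℕ.+ m ≡ N →
              (w n * f′ n) * (w m * g′ m)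
                ≈ w N * (f′ n * (w m * g′ m) + (w n * f′ n) * g′ m + f′ n * g′ m)
    summand n m _ ≡.refl = begin
      (w n * f′ n) * (w m * g′ m)
        ≈⟨ solve 4 (λ r s F G → (r :* F) :* (s :* G) := (r :* s) :* (F :* G)) refl (w n) (w m) (f′ n) (g′ m) ⟩
      (w n * w m) * (f′ n * g′ m)
        ≈⟨ weights n m ⟩
      (w (n ℕ.+ m) * (1# + w n + w m)) * (f′ n * g′ m)
        ≈⟨ solve 5 (λ t r s F G → (t :* (con 1 :+ r :+ s)) :* (F :* G)
                                  := t :* (F :* (s :* G) :+ (r :* F) :* G :+ F :* G))
                 refl (w (n ℕ.+ m)) (w n) (w m) (f′ n) (g′ m) ⟩
      w (n ℕ.+ m) * (f′ n * (w m * g′ m) + (w n * f′ n) * g′ m + f′ n * g′ m)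
        ∎

    coeff-identity : ∀ N → coeff (diagonal w f *ₛ diagonal w g) N
      ≈ coeff (diagonal w (f *ₛ diagonal w g) +ₛ diagonal w (diagonal w f *ₛ g) +ₛ diagonal w (f *ₛ g)) N
    coeff-identity N = begin
      Σ N (λ n → (w n * f′ n) * (w (N ∸ n) * g′ (N ∸ n)))
        ≈⟨ Σ-cong N (λ n n≤N → summand n (N ∸ n) N (ℕ.m+[n∸m]≡n n≤N)) ⟩
      Σ N (λ n → w N * (A n + B n + C n))
        ≈⟨ *-distribˡ-Σ N (w N) _ ⟨
      w N * Σ N (λ n → A n + B n + C n)
        ≈⟨ *-congˡ (trans (Σ-distrib-+ N _ C) (+-congʳ (Σ-distrib-+ N A B))) ⟩
      w N * (Σ N A + Σ N B + Σ N C)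
        ≈⟨ trans (distribˡ _ _ _) (+-congʳ (distribˡ _ _ _)) ⟩
      w N * Σ N A + w N * Σ N B + w N * Σ N C
        ∎
      where
      A B C : ℕ → Carrier
      A n = f′ n * (w (N ∸ n) * g′ (N ∸ n))
      B n = (w n * f′ n) * g′ (N ∸ n)
      C n = f′ n * g′ (N ∸ n)

  ≋-shift : ∀ p {f h} → (∀ m → coeff f (p ℕ.+ m) ≈ coeff h m) → (∀ m → m < p → coeff f m ≈ 0#) →
            f ≋ shift p h
  ≋-shift zero    above below = coeffwise above
  ≋-shift (suc p) {f} above below = coeffwise λ where
    zero    → below 0 (s≤s z≤n)
    (suc m) → coeff-≈ (≋-shift p {series (coeff f ∘ suc)} above (λ m m<p → below (suc m) (s≤s m<p))) m

  shift-causal : ∀ p {f g} m → (∀ i → i ≤ m → coeff f i ≈ coeff g i) → coeff (shift p f) m ≈ coeff (shift p g) m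
  shift-causal zero    m       f≈g = f≈g m ℕ.≤-refl
  shift-causal (suc p) zero    f≈g = refl
  shift-causal (suc p) (suc m) f≈g = shift-causal p m (λ i i≤m → f≈g i (ℕ.m≤n⇒m≤1+n i≤m))

  shift-fixedPoint-unique : ∀ p w {y z} → y ≋ shift (suc p) (w +ₛ y) → z ≋ shift (suc p) (w +ₛ z) → y ≋ z
  shift-fixedPoint-unique p w {y} {z} y-fix z-fix = coeffwise λ m → agreeUpTo m m ℕ.≤-refl
    where
    agreeUpTo : ∀ m i → i ≤ m → coeff y i ≈ coeff z i
    agreeUpTo m       zero    _         = trans (coeff-≈ y-fix 0) (sym (coeff-≈ z-fix 0))
    agreeUpTo (suc m) (suc i) (s≤s i≤m) = begin
      coeff y (suc i)                     ≈⟨ coeff-≈ y-fix (suc i) ⟩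
      coeff (shift p (w +ₛ y)) i          ≈⟨ shift-causal p i (λ j j≤i → +-congˡ (agreeUpTo m j (ℕ.≤-trans j≤i i≤m))) ⟩
      coeff (shift p (w +ₛ z)) i          ≈⟨ coeff-≈ z-fix (suc i) ⟨
      coeff z (suc i)                     ∎

module FixedPointEquations {c ℓ} (R : CommutativeRing c ℓ) where
  open CommutativeRing R
  open import Algebra.Properties.Ring ring using (+-cancelʳ)
  open import Relation.Binary.Reasoning.Setoid setoid
  open import Algebra.Solver.Ring.NaturalCoefficients.Default commutativeSemiring

  -- For r₁ = qⁿ, r₂ = qᵐ: qⁿ/(1 − qⁿ) · qᵐ/(1 − qᵐ) = qⁿ⁺ᵐ/(1 − qⁿ⁺ᵐ) · (1 + qⁿ/(1 − qⁿ) + qᵐ/(1 − qᵐ)),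
  -- stated through the equations y = r(1 + y) so that nothing is divided.
  fixedPoint-product : ∀ {r₁ r₂ y₁ y₂ y} →
    y₁ ≈ r₁ * (1# + y₁) → y₂ ≈ r₂ * (1# + y₂) → y ≈ (r₁ * r₂) * (1# + y) →
    y₁ * y₂ ≈ y * (1# + y₁ + y₂)
  fixedPoint-product {r₁} {r₂} {y₁} {y₂} {y} y₁-fix y₂-fix y-fix = +-cancelʳ (y * (y₁ * y₂)) _ _ (begin
    y₁ * y₂ + y * (y₁ * y₂)
      ≈⟨ solve 3 (λ y₁ y₂ y → y₁ :* y₂ :+ y :* (y₁ :* y₂) := (con 1 :+ y) :* (y₁ :* y₂)) refl y₁ y₂ y ⟩
    (1# + y) * (y₁ * y₂)
      ≈⟨ *-congˡ (*-cong y₁-fix y₂-fix) ⟩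
    (1# + y) * ((r₁ * (1# + y₁)) * (r₂ * (1# + y₂)))
      ≈⟨ solve 5 (λ r₁ r₂ y₁ y₂ y → (con 1 :+ y) :* ((r₁ :* (con 1 :+ y₁)) :* (r₂ :* (con 1 :+ y₂)))
                                   := ((r₁ :* r₂) :* (con 1 :+ y)) :* ((con 1 :+ y₁) :* (con 1 :+ y₂)))
               refl r₁ r₂ y₁ y₂ y ⟩
    ((r₁ * r₂) * (1# + y)) * ((1# + y₁) * (1# + y₂))
      ≈⟨ *-congʳ y-fix ⟨
    y * ((1# + y₁) * (1# + y₂))
      ≈⟨ solve 3 (λ y₁ y₂ y → y :* ((con 1 :+ y₁) :* (con 1 :+ y₂)) := y :* (con 1 :+ y₁ :+ y₂) :+ y :* (y₁ :* y₂))
               refl y₁ y₂ y ⟩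
    y * (1# + y₁ + y₂) + y * (y₁ * y₂)
      ∎)

module ShiftFixedPoints {c ℓ} (R : CommutativeRing c ℓ) where
  open FormalPowerSeries R
  open CommutativeRing powerSeriesRing
    using (setoid; *-congˡ; *-congʳ; *-assoc; *-identityˡ; distribʳ)
    renaming (trans to ≋-trans; sym to ≋-sym; +-congʳ to +ₛ-congʳ)
  open import Algebra.Properties.Semiring.Exp (CommutativeRing.semiring powerSeriesRing) using (_^_; ^-homo-*)
  open FixedPointEquations powerSeriesRing using (fixedPoint-product)
  open import Relation.Binary.Reasoning.Setoid setoid

  x^-*≋shift : ∀ p f → x ^ p *ₛ f ≋ shift p f
  x^-*≋shift zero    f = coeffwise (coeff-≈ (*-identityˡ f))
  x^-*≋shift (suc p) f = begin
    (x *ₛ x ^ p) *ₛ f     ≈⟨ *-assoc x (x ^ p) f ⟩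
    x *ₛ (x ^ p *ₛ f)     ≈⟨ *-congˡ (x^-*≋shift p f) ⟩
    x *ₛ shift p f        ≈⟨ x*≋shift (shift p f) ⟩
    shift 1 (shift p f)   ≈⟨ coeffwise (λ { zero → refl ; (suc m) → refl }) ⟩
    shift (suc p) f       ∎
    where open CommutativeRing R using (refl)

  fixedPoint-x^ : ∀ p {y} → y ≋ shift p (1ₛ +ₛ y) → y ≋ x ^ p *ₛ (1ₛ +ₛ y)
  fixedPoint-x^ p {y} y-fix = ≋-trans y-fix (≋-sym (x^-*≋shift p (1ₛ +ₛ y)))

  fixedPoint-*ʳ : ∀ p {y} w → y ≋ shift p (1ₛ +ₛ y) → y *ₛ w ≋ shift p (w +ₛ y *ₛ w)
  fixedPoint-*ʳ p {y} w y-fix = begin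
    y *ₛ w                         ≈⟨ *-congʳ (fixedPoint-x^ p y-fix) ⟩
    (x ^ p *ₛ (1ₛ +ₛ y)) *ₛ w      ≈⟨ *-assoc _ _ w ⟩
    x ^ p *ₛ ((1ₛ +ₛ y) *ₛ w)      ≈⟨ *-congˡ (≋-trans (distribʳ w 1ₛ y) (+ₛ-congʳ (*-identityˡ w))) ⟩
    x ^ p *ₛ (w +ₛ y *ₛ w)         ≈⟨ x^-*≋shift p _ ⟩
    shift p (w +ₛ y *ₛ w)          ∎

  shift-fixedPoint-product : ∀ p r {y₁ y₂ y} →
    y₁ ≋ shift p (1ₛ +ₛ y₁) → y₂ ≋ shift r (1ₛ +ₛ y₂) → y ≋ shift (p ℕ.+ r) (1ₛ +ₛ y) →
    y₁ *ₛ y₂ ≋ y *ₛ (1ₛ +ₛ y₁ +ₛ y₂)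
  shift-fixedPoint-product p r y₁-fix y₂-fix y-fix =
    fixedPoint-product (fixedPoint-x^ p y₁-fix) (fixedPoint-x^ r y₂-fix)
                       (≋-trans (fixedPoint-x^ (p ℕ.+ r) y-fix) (*-congʳ (^-homo-* x p r)))

open import Data.Rational using (ℚ; 0ℚ; 1ℚ) renaming (_+_ to _+ℚ_; _*_ to _*ℚ_; -_ to -ℚ_)
import Data.Rational.Properties as ℚ

ℚ-ring : CommutativeRing _ _
ℚ-ring = ℚ.+-*-commutativeRing

sumFrom1-suc : ∀ K h → sumFrom1 (suc K) h ≡ h 1 +ℚ sumFrom1 K (h ∘ suc)
sumFrom1-suc zero    h = ≡.trans (ℚ.+-identityˡ (h 1)) (≡.sym (ℚ.+-identityʳ (h 1)))
sumFrom1-suc (suc K) h = ≡.trans (≡.cong (_+ℚ h (suc (suc K))) (sumFrom1-suc K h))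
                                 (ℚ.+-assoc (h 1) (sumFrom1 K (h ∘ suc)) (h (suc (suc K))))

sumFrom1-cong : ∀ K {h k} → (∀ j → h j ≡ k j) → sumFrom1 K h ≡ sumFrom1 K k
sumFrom1-cong zero    h≡k = ≡.refl
sumFrom1-cong (suc K) h≡k = ≡.cong₂ _+ℚ_ (sumFrom1-cong K h≡k) (h≡k (suc K))

sumFrom1-vanishingTail : ∀ {R K} h → R ≤ K → (∀ j → R < j → h j ≡ 0ℚ) → sumFrom1 K h ≡ sumFrom1 R h
sumFrom1-vanishingTail {R} h R≤K tail≡0 =
  ≡.trans (≡.cong (λ K → sumFrom1 K h) (≡.sym (ℕ.m∸n+n≡m R≤K))) (extend (_ ∸ R))
  where
  extend : ∀ d → sumFrom1 (d ℕ.+ R) h ≡ sumFrom1 R h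
  extend zero    = ≡.refl
  extend (suc d) = ≡.trans (≡.cong₂ _+ℚ_ (extend d) (tail≡0 (suc d ℕ.+ R) (s≤s (ℕ.m≤n+m R d))))
                           (ℚ.+-identityʳ _)

-- The summand of `shiftSum g M (suc n)` is where-bound and cannot be referred to;
-- unifying `shiftSum g M (suc n) ≡ sumFrom1 M s` with its definition recovers it.
summandOf : ∀ M {s : ℕ → ℚ} (x : ℚ) → x ≡ sumFrom1 M s → ℕ → ℚ
summandOf M {s} _ _ = s

shiftSummand : Series → ℕ → ℕ → ℕ → ℚ
shiftSummand g M n = summandOf M (shiftSum g M (suc n)) ≡.refl

shiftSummand-≤ : ∀ g M n j → j ℕ.* suc n ≤ M → shiftSummand g M n j ≡ g (M ∸ j ℕ.* suc n) (suc n)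
shiftSummand-≤ g M n j jp≤M with j ℕ.* suc n ℕ.≤? M
... | yes _    = ≡.refl
... | no  jp≰M = ⊥-elim (jp≰M jp≤M)

shiftSummand-> : ∀ g M n j → M < j ℕ.* suc n → shiftSummand g M n j ≡ 0ℚ
shiftSummand-> g M n j M<jp with j ℕ.* suc n ℕ.≤? M
... | yes jp≤M = ⊥-elim (ℕ.<⇒≱ M<jp jp≤M)
... | no  _    = ≡.refl

shiftSum-step : ∀ g n M → shiftSum g (suc n ℕ.+ M) (suc n) ≡ g M (suc n) +ℚ shiftSum g M (suc n)
shiftSum-step g n M = ≡.trans (sumFrom1-suc (n ℕ.+ M) _)
  (≡.cong₂ _+ℚ_ summand-one (≡.trans (sumFrom1-cong (n ℕ.+ M) summand-suc)
                             (sumFrom1-vanishingTail _ (ℕ.m≤n+m M n) summand-beyond)))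
  where
  p = suc n
  summand-one : shiftSummand g (p ℕ.+ M) n 1 ≡ g M p
  summand-one =
    ≡.trans (shiftSummand-≤ g (p ℕ.+ M) n 1 (ℕ.≤-trans (ℕ.≤-reflexive (ℕ.*-identityˡ p)) (ℕ.m≤m+n p M)))
            (≡.cong (λ i → g i p) (≡.trans (≡.cong (p ℕ.+ M ∸_) (ℕ.*-identityˡ p)) (ℕ.m+n∸m≡n p M)))
  summand-suc : ∀ j → shiftSummand g (p ℕ.+ M) n (suc j) ≡ shiftSummand g M n j
  summand-suc j with ℕ.≤-<-connex (j ℕ.* p) M
  ... | inj₁ jp≤M = ≡.trans (shiftSummand-≤ g (p ℕ.+ M) n (suc j) (ℕ.+-monoʳ-≤ p jp≤M))
                            (≡.trans (≡.cong (λ i → g i p) (ℕ.[m+n]∸[m+o]≡n∸o p M (j ℕ.* p)))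
                                     (≡.sym (shiftSummand-≤ g M n j jp≤M)))
  ... | inj₂ M<jp = ≡.trans (shiftSummand-> g (p ℕ.+ M) n (suc j) (ℕ.+-monoʳ-< p M<jp))
                            (≡.sym (shiftSummand-> g M n j M<jp))
  summand-beyond : ∀ j → M < j → shiftSummand g M n j ≡ 0ℚ
  summand-beyond j M<j = shiftSummand-> g M n j (ℕ.<-≤-trans M<j (ℕ.m≤m*n j p))

shiftSum-below : ∀ g n M → M < suc n → shiftSum g M (suc n) ≡ 0ℚ
shiftSum-below g n M M<p = sumFrom1-vanishingTail {K = M} _ z≤n summand-beyond
  where
  summand-beyond : ∀ j → 0 < j → shiftSummand g M n j ≡ 0ℚ
  summand-beyond (suc j) _ = shiftSummand-> g M n (suc j) (ℕ.<-≤-trans M<p (ℕ.m≤n*m (suc n) (suc j)))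

module Q = FormalPowerSeries ℚ-ring
module Z = FormalPowerSeries Q.powerSeriesRing

module Qᴿ = CommutativeRing Q.powerSeriesRing
module Zᴿ = CommutativeRing Z.powerSeriesRing

⟦_⟧ : Series → Z.PowerSeries
Q.coeff (Z.coeff ⟦ f ⟧ n) m = f m n

≋⇒≈S : ∀ {f g} → ⟦ f ⟧ Z.≋ ⟦ g ⟧ → f ≈S g
≋⇒≈S f≋g m n = Q.coeff-≈ (Z.coeff-≈ f≋g n) m

sumTo≡Σ : ∀ n h → sumTo n h ≡ Q.Σ n h
sumTo≡Σ zero    h = ≡.refl
sumTo≡Σ (suc n) h = ≡.cong (_+ℚ h (suc n)) (sumTo≡Σ n h)

coeff-Σ : ∀ n H m → Q.coeff (Z.Σ n H) m ≡ Q.Σ n (λ j → Q.coeff (H j) m)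
coeff-Σ zero    H m = ≡.refl
coeff-Σ (suc n) H m = ≡.cong (_+ℚ Q.coeff (H (suc n)) m) (coeff-Σ n H m)

⟦⊕⟧ : ∀ f g → ⟦ f ⊕ g ⟧ Z.≋ ⟦ f ⟧ Z.+ₛ ⟦ g ⟧
⟦⊕⟧ f g = Z.coeffwise λ n → Q.coeffwise λ m → ≡.refl

⟦⊗⟧ : ∀ f g → ⟦ f ⊗ g ⟧ Z.≋ ⟦ f ⟧ Z.*ₛ ⟦ g ⟧
⟦⊗⟧ f g = Z.coeffwise λ n → Q.coeffwise λ m → begin
  sumTo m (λ i → sumTo n (λ j → f i j *ℚ g (m ∸ i) (n ∸ j)))
    ≡⟨ ≡.trans (sumTo≡Σ m _) (Q.Σ-cong m λ i _ → sumTo≡Σ n _) ⟩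
  Q.Σ m (λ i → Q.Σ n (λ j → f i j *ℚ g (m ∸ i) (n ∸ j)))
    ≡⟨ Q.Σ-comm m n _ ⟩
  Q.Σ n (λ j → Q.Σ m (λ i → f i j *ℚ g (m ∸ i) (n ∸ j)))
    ≡⟨ coeff-Σ n _ m ⟨
  Q.coeff (Z.coeff (⟦ f ⟧ Z.*ₛ ⟦ g ⟧) n) m
    ∎
  where open ≡.≡-Reasoning

1/[1-z] : Series
1/[1-z] m _ = Q.coeff Q.1ₛ m

-- qⁿ/(1 − qⁿ) = Σ_{j ≥ 1} q^{jn} (0 for n = 0): the zⁿ-coefficient of Σ_{j ≥ 1} g(q, qʲz) for g = 1/(1 − z).
geometric : ℕ → Q.PowerSeries
Q.coeff (geometric n) M = shiftSum 1/[1-z] M n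

geometric-fixedPoint : ∀ n → geometric (suc n) Q.≋ Q.shift (suc n) (Q.1ₛ Q.+ₛ geometric (suc n))
geometric-fixedPoint n = Q.≋-shift (suc n) (shiftSum-step 1/[1-z] n) (shiftSum-below 1/[1-z] n)

geometric-product : ∀ n m → geometric (suc n) Q.*ₛ geometric (suc m)
                          Q.≋ geometric (suc n ℕ.+ suc m) Q.*ₛ (Q.1ₛ Q.+ₛ geometric (suc n) Q.+ₛ geometric (suc m))
geometric-product n m = shift-fixedPoint-product (suc n) (suc m)
  (geometric-fixedPoint n) (geometric-fixedPoint m) (geometric-fixedPoint (n ℕ.+ suc m))
  where open ShiftFixedPoints ℚ-ring

column-shiftSum : ∀ g n → Z.coeff ⟦ shiftSum g ⟧ (suc n) Q.≋ geometric (suc n) Q.*ₛ Z.coeff ⟦ g ⟧ (suc n)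
column-shiftSum g n = Q.shift-fixedPoint-unique n (Z.coeff ⟦ g ⟧ (suc n))
  (Q.≋-shift (suc n) (shiftSum-step g n) (shiftSum-below g n))
  (fixedPoint-*ʳ (suc n) _ (geometric-fixedPoint n))
  where open ShiftFixedPoints ℚ-ring

⟦shiftSum⟧ : ∀ g → ⟦ shiftSum g ⟧ Z.≋ Z.diagonal geometric ⟦ g ⟧
⟦shiftSum⟧ g = Z.coeffwise λ where
  zero    → Q.coeffwise λ M → ≡.sym (Q.Σ-zero M λ i _ → ℚ.*-zeroˡ (g (M ∸ i) 0))
  (suc n) → column-shiftSum g n

⟦actB⟧ : ∀ h → ⟦ actB h ⟧ Z.≋ Z.u Z.*ₛ ⟦ h ⟧
⟦actB⟧ h = Z.coeffwise λ where
  zero    → Q.coeffwise (Q.coeff-≈ (Qᴿ.sym (Z.coeff-u*-zero ⟦ h ⟧)))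
  (suc n) → Qᴿ.trans (Q.coeffwise λ m → ≡.trans (sumTo≡Σ n _) (≡.sym (coeff-Σ n (Z.coeff ⟦ h ⟧) m)))
                     (Qᴿ.sym (Z.coeff-u*-suc ⟦ h ⟧ n))

ℏ : Z.PowerSeries
ℏ = Z.const (Q.1ₛ Q.+ₛ Q.-ₛ Q.x)

⟦mul1-q⟧ : ∀ h → ⟦ mul1-q h ⟧ Z.≋ ℏ Z.*ₛ ⟦ h ⟧
⟦mul1-q⟧ h = Z.coeffwise λ n → Qᴿ.trans (Q.coeffwise (column n)) (Qᴿ.sym (Z.coeff-const-* _ ⟦ h ⟧ n))
  where
  column : ∀ n m → mul1-q h m n ≡ Q.coeff ((Q.1ₛ Q.+ₛ Q.-ₛ Q.x) Q.*ₛ Z.coeff ⟦ h ⟧ n) m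
  column n zero    = ≡.sym (≡.trans (Q.coeff-[1-x]* (Z.coeff ⟦ h ⟧ n) 0) (ℚ.+-identityʳ (h 0 n)))
  column n (suc m) = ≡.sym (Q.coeff-[1-x]* (Z.coeff ⟦ h ⟧ n) (suc m))

act : Letter → Z.PowerSeries → Z.PowerSeries
act a F = ℏ Z.*ₛ Z.diagonal geometric F
act b F = Z.u Z.*ₛ F

act-cong : ∀ α {F G} → F Z.≋ G → act α F Z.≋ act α G
act-cong a F≋G = Zᴿ.*-congˡ (Z.diagonal-cong geometric F≋G)
act-cong b F≋G = Zᴿ.*-congˡ F≋G

⟦actLetter⟧ : ∀ α h → ⟦ actLetter α h ⟧ Z.≋ act α ⟦ h ⟧
⟦actLetter⟧ a h = Zᴿ.trans (⟦mul1-q⟧ (shiftSum h)) (Zᴿ.*-congˡ (⟦shiftSum⟧ h))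
⟦actLetter⟧ b h = ⟦actB⟧ h

⟦actLetter²⟧ : ∀ α β h → ⟦ actLetter α (actLetter β h) ⟧ Z.≋ act α (act β ⟦ h ⟧)
⟦actLetter²⟧ α β h = Zᴿ.trans (⟦actLetter⟧ α (actLetter β h)) (act-cong α (⟦actLetter⟧ β h))

diamond : Letter → Letter → Z.PowerSeries → Z.PowerSeries
diamond a a F = ℏ Z.*ₛ act a F
diamond a b F = Z.-ₛ act a (act b F)
diamond b a F = Z.-ₛ act a (act b F)
diamond b b F = Z.-ₛ act b (act b F)

diamond-cong : ∀ α β {F G} → F Z.≋ G → diamond α β F Z.≋ diamond α β G
diamond-cong a a F≋G = Zᴿ.*-congˡ (act-cong a F≋G)
diamond-cong a b F≋G = Zᴿ.-‿cong (act-cong a (act-cong b F≋G))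
diamond-cong b a F≋G = Zᴿ.-‿cong (act-cong a (act-cong b F≋G))
diamond-cong b b F≋G = Zᴿ.-‿cong (act-cong b (act-cong b F≋G))

⟦scaleS-1⊕zeroS⟧ : ∀ h → ⟦ scaleS 1ℚ h ⊕ zeroS ⟧ Z.≋ ⟦ h ⟧
⟦scaleS-1⊕zeroS⟧ h = Z.coeffwise λ n → Q.coeffwise λ m →
  ≡.trans (ℚ.+-identityʳ _) (ℚ.*-identityˡ (h m n))

⟦scaleS-[-1]⊕zeroS⟧ : ∀ h → ⟦ scaleS (-ℚ 1ℚ) h ⊕ zeroS ⟧ Z.≋ Z.-ₛ ⟦ h ⟧
⟦scaleS-[-1]⊕zeroS⟧ h = Z.coeffwise λ n → Q.coeffwise λ m →
  ≡.trans (ℚ.+-identityʳ _) (-1*x≈-x (h m n))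
  where open Algebra.Properties.Ring (CommutativeRing.ring ℚ-ring) using (-1*x≈-x)

⟦actH-⋄q⟧ : ∀ α β h → ⟦ actH (α ⋄q β) h ⟧ Z.≋ diamond α β ⟦ h ⟧
⟦actH-⋄q⟧ a a h = Zᴿ.trans (⟦scaleS-1⊕zeroS⟧ _) (Zᴿ.trans (⟦mul1-q⟧ _) (Zᴿ.*-congˡ (⟦actLetter⟧ a h)))
⟦actH-⋄q⟧ a b h = Zᴿ.trans (⟦scaleS-[-1]⊕zeroS⟧ _) (Zᴿ.-‿cong (⟦actLetter²⟧ a b h))
⟦actH-⋄q⟧ b a h = Zᴿ.trans (⟦scaleS-[-1]⊕zeroS⟧ _) (Zᴿ.-‿cong (⟦actLetter²⟧ a b h))
⟦actH-⋄q⟧ b b h = Zᴿ.trans (⟦scaleS-[-1]⊕zeroS⟧ _) (Zᴿ.-‿cong (⟦actLetter²⟧ b b h))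

ℏ-out-of-diagonal : ∀ {X Y} → X Z.≋ ℏ Z.*ₛ Y → Z.diagonal geometric X Z.≋ ℏ Z.*ₛ Z.diagonal geometric Y
ℏ-out-of-diagonal X≋ℏY = Zᴿ.trans (Z.diagonal-cong geometric X≋ℏY) (Z.diagonal-const-* geometric _ _)

x≈w+[x-w] : ∀ w x → x Z.≋ w Z.+ₛ (x Z.+ₛ Z.-ₛ w)
x≈w+[x-w] w x = Zᴿ.sym (Zᴿ.trans (Zᴿ.sym (Zᴿ.+-assoc w x (Z.-ₛ w))) (xyx⁻¹≈y w x))
  where open import Algebra.Properties.AbelianGroup Zᴿ.+-abelianGroup using (xyx⁻¹≈y)

x≈x+[w-w] : ∀ w x → x Z.≋ x Z.+ₛ (w Z.+ₛ Z.-ₛ w)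
x≈x+[w-w] w x = Zᴿ.sym (Zᴿ.trans (Zᴿ.+-congˡ (Zᴿ.-‿inverseʳ w)) (Zᴿ.+-identityʳ x))

product-rule : ∀ α β {F G} → Z.coeff F 0 Q.≋ Q.0ₛ → Z.coeff G 0 Q.≋ Q.0ₛ →
  act α F Z.*ₛ act β G
    Z.≋ act α (F Z.*ₛ act β G) Z.+ₛ (act β (act α F Z.*ₛ G) Z.+ₛ diamond α β (F Z.*ₛ G))
product-rule a a {F} {G} F₀≈0 G₀≈0 = begin
  (ℏ * D F) * (ℏ * D G)
    ≈⟨ solve 3 (λ h X Y → (h :* X) :* (h :* Y) := (h :* h) :* (X :* Y)) refl ℏ (D F) (D G) ⟩
  (ℏ * ℏ) * (D F * D G)
    ≈⟨ *-congˡ (Z.diagonal-rotaBaxter geometric geometric-product F₀≈0 G₀≈0) ⟩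
  (ℏ * ℏ) * (D (F * D G) + D (D F * G) + D (F * G))
    ≈⟨ solve 4 (λ h X Y W → (h :* h) :* (X :+ Y :+ W) := h :* (h :* X) :+ (h :* (h :* Y) :+ h :* (h :* W)))
               refl ℏ (D (F * D G)) (D (D F * G)) (D (F * G)) ⟩
  ℏ * (ℏ * D (F * D G)) + (ℏ * (ℏ * D (D F * G)) + ℏ * (ℏ * D (F * G)))
    ≈⟨ +-cong (*-congˡ (ℏ-out-of-diagonal (x∙yz≈y∙xz F ℏ (D G))))
              (+-congʳ (*-congˡ (ℏ-out-of-diagonal (*-assoc ℏ (D F) G)))) ⟨
  ℏ * D (F * (ℏ * D G)) + (ℏ * D ((ℏ * D F) * G) + ℏ * (ℏ * D (F * G)))
    ∎
  where
  open Zᴿ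
  open import Relation.Binary.Reasoning.Setoid setoid
  open import Algebra.Solver.Ring.NaturalCoefficients.Default commutativeSemiring
  open import Algebra.Properties.CommutativeSemigroup *-commutativeSemigroup using (x∙yz≈y∙xz)
  D = Z.diagonal geometric
product-rule a b {F} {G} _ _ = begin
  act a F * (u * G)
    ≈⟨ x≈w+[x-w] W _ ⟩
  W + (act a F * (u * G) + - W)
    ≈⟨ +-cong (act-cong a (x∙yz≈y∙xz F u G)) (+-congʳ (x∙yz≈y∙xz u (act a F) G)) ⟨
  act a (F * (u * G)) + (u * (act a F * G) + - W)
    ∎
  where
  open Zᴿ
  open Z using (u)
  open import Relation.Binary.Reasoning.Setoid setoid
  open import Algebra.Properties.CommutativeSemigroup *-commutativeSemigroup using (x∙yz≈y∙xz)
  W = act a (act b (F * G))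
product-rule b a {F} {G} _ _ = begin
  (u * F) * act a G
    ≈⟨ x≈x+[w-w] W _ ⟩
  (u * F) * act a G + (W + - W)
    ≈⟨ +-cong (sym (*-assoc u F (act a G))) (+-congʳ (act-cong a (*-assoc u F G))) ⟨
  u * (F * act a G) + (act a ((u * F) * G) + - W)
    ∎
  where
  open Zᴿ
  open Z using (u)
  open import Relation.Binary.Reasoning.Setoid setoid
  W = act a (act b (F * G))
product-rule b b {F} {G} _ _ = begin
  (u * F) * (u * G)
    ≈⟨ x≈x+[w-w] W _ ⟩
  (u * F) * (u * G) + (W + - W)
    ≈⟨ +-cong (sym (*-assoc u F (u * G))) (+-congʳ (*-congˡ (*-assoc u F G))) ⟨
  u * (F * (u * G)) + (u * ((u * F) * G) + - W)
    ∎
  where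
  open Zᴿ
  open Z using (u)
  open import Relation.Binary.Reasoning.Setoid setoid
  W = act b (act b (F * G))

proposition3p17 : (f g : Series) → InZ f → InZ g → (α β : Letter) →
    (actLetter α f ⊗ actLetter β g)
      ≈S (actLetter α (f ⊗ actLetter β g)
          ⊕ (actLetter β (actLetter α f ⊗ g)
          ⊕ actH (α ⋄q β) (f ⊗ g)))
proposition3p17 f g f₀≡0 g₀≡0 α β = ≋⇒≈S (begin
  ⟦ actLetter α f ⊗ actLetter β g ⟧
    ≈⟨ trans (⟦⊗⟧ _ _) (*-cong (⟦actLetter⟧ α f) (⟦actLetter⟧ β g)) ⟩
  act α F * act β G
    ≈⟨ product-rule α β (Q.coeffwise f₀≡0) (Q.coeffwise g₀≡0) ⟩
  act α (F * act β G) + (act β (act α F * G) + diamond α β (F * G))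
    ≈⟨ trans (⟦⊕⟧ _ _) (+-cong ⟦α-term⟧ (trans (⟦⊕⟧ _ _) (+-cong ⟦β-term⟧ ⟦⋄q-term⟧))) ⟨
  ⟦ actLetter α (f ⊗ actLetter β g) ⊕ (actLetter β (actLetter α f ⊗ g) ⊕ actH (α ⋄q β) (f ⊗ g)) ⟧
    ∎)
  where
  open Zᴿ
  open import Relation.Binary.Reasoning.Setoid setoid
  F = ⟦ f ⟧
  G = ⟦ g ⟧
  ⟦α-term⟧ : ⟦ actLetter α (f ⊗ actLetter β g) ⟧ ≈ act α (F * act β G)
  ⟦α-term⟧ = trans (⟦actLetter⟧ α _) (act-cong α (trans (⟦⊗⟧ f _) (*-congˡ (⟦actLetter⟧ β g))))
  ⟦β-term⟧ : ⟦ actLetter β (actLetter α f ⊗ g) ⟧ ≈ act β (act α F * G)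
  ⟦β-term⟧ = trans (⟦actLetter⟧ β _) (act-cong β (trans (⟦⊗⟧ _ g) (*-congʳ (⟦actLetter⟧ α f))))
  ⟦⋄q-term⟧ : ⟦ actH (α ⋄q β) (f ⊗ g) ⟧ ≈ diamond α β (F * G)
  ⟦⋄q-term⟧ = trans (⟦actH-⋄q⟧ α β _) (diamond-cong α β (⟦⊗⟧ f g))
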